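{- Let $v,k,r,\lambda,\mu$ be positive integers and let $C_1,\ldots,C_r$ be $v\times v$ $(0,1)$-matrices such that (a) $\sum_{i=1}^rC_i=(r-\lambda)I_v+\lambda J_v$, (b) $C_iC_i^\top=kC_i$ for every $i$, and (c) $C_iC_j^\top=\mu J_v$ for all distinct $i,j$; put $C_0=O_v$. For a Latin square $L$ on $\{0,1,\ldots,r\}$ with $(a,b)$-entry $l(a,b)$, let $\tilde L=(C_{l(a,b)})_{a,b=0}^r$. Let $f\ge3$ and let $L_{i,j}$ ($i,j\in\{1,\ldots,f\}$, $i\ne j$) be linked MOLS on $\{0,1,\ldots,r\}$, each with all diagonal entries equal to $0$, and set $A_{i,j}=\tilde L_{i,j}$. Then for any mutually distinct $i,j,l$, $$A_{i,j}A_{j,l}=kA_{i,l}+2\mu K_{r+1,v}+(r-2)\mu J_{(r+1)v}.$$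
   Context: $I_t$, $J_t$, $O_t$ denote the $t\times t$ identity, all-ones and zero matrices; $K_{m,n}=I_m\otimes J_n$. A Latin square of size $s$ on a symbol set of size $s$ is an $s\times s$ array in which each symbol occurs exactly once in each row and each column. Two Latin squares $L_1,L_2$ of size $s$ on the same symbol set are orthogonal (here) if for every row $a$ of $L_1$ and every row $b$ of $L_2$ there is exactly one position $c$ with $L_1(a,c)=L_2(b,c)$; for such a pair, the Latin square obtained from $L_1$ and $L_2$ (in this order) is the array whose $(a,b)$-entry is $L_1(a,c)=L_2(b,c)$ for this unique $c$. Latin squares $L_{i,j}$ ($i,j\in\{1,\ldots,f\}$, $i\ne j$, $f\ge3$) on a common symbol set are linked MOLS if for all mutually distinct $i,j,k$, $L_{i,k}$ and $L_{j,k}$ are orthogonal and the Latin square obtained from $L_{i,k}$ and $L_{j,k}$ (in this order) equals $L_{i,j}$. -}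

module Defs where

open import Data.Nat as ℕ using (ℕ; zero; suc)
open import Data.Fin using (Fin; zero; suc; remQuot)
open import Data.Integer using (ℤ; +_; _+_; _*_; _-_; 0ℤ; 1ℤ)
open import Data.Product using (Σ; _×_; _,_; proj₁; proj₂)
open import Data.Sum using (_⊎_)
open import Relation.Binary.PropositionalEquality using (_≡_; _≢_)
open import Relation.Nullary using (Dec; yes; no)
open import Data.Fin using (_≟_)

Matrix : ℕ → ℕ → Set
Matrix m n = Fin m → Fin n → ℤ

∑ : (n : ℕ) → (Fin n → ℤ) → ℤ
∑ zero    g = 0ℤ
∑ (suc n) g = g zero + ∑ n (λ i → g (suc i))

_⊗_ : ∀ {m n p} → Matrix m n → Matrix n p → Matrix m p
_⊗_ {n = n} A B i j = ∑ n (λ t → A i t * B t j)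

_ᵀ : ∀ {m n} → Matrix m n → Matrix n m
(A ᵀ) i j = A j i

_⊕_ : ∀ {m n} → Matrix m n → Matrix m n → Matrix m n
(A ⊕ B) i j = A i j + B i j

_·_ : ∀ {m n} → ℤ → Matrix m n → Matrix m n
(c · A) i j = c * A i j

I : (t : ℕ) → Matrix t t
I t i j with i ≟ j
... | yes _ = 1ℤ
... | no  _ = 0ℤ

J : (t : ℕ) → Matrix t t
J t i j = 1ℤ

O : (t : ℕ) → Matrix t t
O t i j = 0ℤ

-- K_{m,n} = I_m ⊗ J_n, as an (m*n)×(m*n) matrix; row index combine a x ↦ (a , x)
K : (m n : ℕ) → Matrix (m ℕ.* n) (m ℕ.* n)
K m n p q = I m (proj₁ (remQuot {m} n p)) (proj₁ (remQuot {m} n q))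

Is01 : ∀ {m n} → Matrix m n → Set
Is01 A = ∀ i j → (A i j ≡ 0ℤ) ⊎ (A i j ≡ 1ℤ)

-- Σ_{i=1}^r C_i  (C indexed by Fin r, index i standing for C_{i+1})
∑M : ∀ {v} (r : ℕ) → (Fin r → Matrix v v) → Matrix v v
∑M r C x y = ∑ r (λ i → C i x y)

Square : ℕ → Set
Square s = Fin s → Fin s → Fin s

IsLatin : ∀ {s} → Square s → Set
IsLatin {s} L =
  (∀ a σ → Σ (Fin s) λ c → (L a c ≡ σ) × (∀ c' → L a c' ≡ σ → c' ≡ c)) ×
  (∀ c σ → Σ (Fin s) λ a → (L a c ≡ σ) × (∀ a' → L a' c ≡ σ → a' ≡ a))

Orthogonal : ∀ {s} → Square s → Square s → Set
Orthogonal {s} L₁ L₂ = ∀ a b →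
  Σ (Fin s) λ c → (L₁ a c ≡ L₂ b c) × (∀ c' → L₁ a c' ≡ L₂ b c' → c' ≡ c)

ObtainedFrom : ∀ {s} → Square s → Square s → Square s → Set
ObtainedFrom L₁ L₂ L = ∀ a b c → L₁ a c ≡ L₂ b c → L a b ≡ L₁ a c

-- linked MOLS indexed by Fin f (index i standing for i+1); values at i = j are irrelevant
LinkedMOLS : ∀ {s} (f : ℕ) → (Fin f → Fin f → Square s) → Set
LinkedMOLS f L =
  (∀ i j → i ≢ j → IsLatin (L i j)) ×
  (∀ i j k → i ≢ j → j ≢ k → i ≢ k →
     Orthogonal (L i k) (L j k) × ObtainedFrom (L i k) (L j k) (L i j))

Cext : ∀ {v r} → (Fin r → Matrix v v) → Fin (suc r) → Matrix v v
Cext C zero    = λ _ _ → 0ℤ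
Cext C (suc i) = C i

-- L̃ = (C_{l(a,b)})_{a,b=0}^r, as a ((r+1)v)×((r+1)v) matrix, block (a,b), inner entry (x,y)
tilde : ∀ {v r} → (Fin r → Matrix v v) → Square (suc r) → Matrix (suc r ℕ.* v) (suc r ℕ.* v)
tilde {v} {r} C L p q with remQuot {suc r} v p | remQuot {suc r} v q
... | a , x | b , y = Cext C (L a b) x y

_≐_ : ∀ {m n} → Matrix m n → Matrix m n → Set
A ≐ B = ∀ i j → A i j ≡ B i j
infix 4 _≐_

module Submission where

-- Block (a , b) of
-- Ã_{ij} Ã_{jl} is  Σ_c C_{L_ij(a,c)} C_{L_jl(c,b)}.  Hypothesis (b) with k ≥ 1
-- forces every C_s to be symmetric, so a product C_s C_t only depends on the
-- symbols: it is O if s or t is 0, k C_s if s = t, and μ J otherwise.  Linkedness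
-- gives L_jl(c,b) = L_lj(b,c), so the block is a sum over the columns c of the
-- pairs (x_c , y_c) taken from row a of L_ij and row b of L_lj.  These rows
-- vanish exactly in column a resp. b (zero diagonal + Latin property) and agree
-- exactly in one column m (orthogonality), where x_m = L_il(a,b).  Counting the
-- columns of each kind gives  k C_{L_il(a,b)} + 2μ[a = b] + (r-2)μ J, which is
-- block (a , b) of the right-hand side.

open import Defs
open import Data.Nat using (ℕ; suc; _≥_; _*_)
open import Data.Fin using (Fin)
open import Data.Integer using (ℤ; +_; _-_) renaming (_*_ to _*ℤ_)
open import Relation.Binary.PropositionalEquality using (_≡_; _≢_)

import Data.Nat as ℕ
open import Data.Nat using (zero)
open import Data.Fin using (zero; suc; combine; remQuot; _↑ˡ_; _↑ʳ_; _≟_)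
open import Data.Fin.Properties using (remQuot-combine; combine-remQuot; suc-injective)
open import Data.Integer using (0ℤ; 1ℤ; -_) renaming (_+_ to _+ℤ_)
open import Data.Integer.Properties
  using (+-*-semiring; +-identityˡ; +-identityʳ; +-assoc; *-zeroˡ; *-zeroʳ; *-identityˡ; *-identityʳ;
         *-comm; *-cancelˡ-≡; pos-+; pos-*)
open import Algebra.Properties.Semiring.Sum +-*-semiring using (sum; sum-cong-≗; ∑-distrib-+; sum-replicate-zero)
open import Data.Integer.Tactic.RingSolver using (solve-∀)
open import Data.Product using (_×_; _,_; proj₁; proj₂)
open import Function using (_∘_)
open import Relation.Binary.PropositionalEquality using (refl; sym; trans; cong; cong₂; subst₂; ≢-sym; module ≡-Reasoning)
open import Relation.Nullary using (Dec; yes; no)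
open import Data.Empty using (⊥-elim)

open ≡-Reasoning

∑≡sum : ∀ n (g : Fin n → ℤ) → ∑ n g ≡ sum g
∑≡sum zero    g = refl
∑≡sum (suc n) g = cong (g zero +ℤ_) (∑≡sum n (g ∘ suc))

∑-cong : ∀ n {f g : Fin n → ℤ} → (∀ c → f c ≡ g c) → ∑ n f ≡ ∑ n g
∑-cong n {f} {g} f≗g = trans (∑≡sum n f) (trans (sum-cong-≗ f≗g) (sym (∑≡sum n g)))

∑-+ : ∀ n (f g : Fin n → ℤ) → ∑ n (λ c → f c +ℤ g c) ≡ ∑ n f +ℤ ∑ n g
∑-+ n f g = begin
  ∑ n (λ c → f c +ℤ g c)  ≡⟨ ∑≡sum n _ ⟩
  sum (λ c → f c +ℤ g c)  ≡⟨ ∑-distrib-+ f g ⟩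
  sum f +ℤ sum g          ≡⟨ sym (cong₂ _+ℤ_ (∑≡sum n f) (∑≡sum n g)) ⟩
  ∑ n f +ℤ ∑ n g          ∎

∑-zero : ∀ n → ∑ n (λ _ → 0ℤ) ≡ 0ℤ
∑-zero n = trans (∑≡sum n _) (sum-replicate-zero n)

∑-const : ∀ n e → ∑ n (λ _ → e) ≡ + n *ℤ e
∑-const zero    e = sym (*-zeroˡ e)
∑-const (suc n) e = begin
  e +ℤ ∑ n (λ _ → e)   ≡⟨ cong (e +ℤ_) (∑-const n e) ⟩
  e +ℤ + n *ℤ e        ≡⟨ distrib e (+ n) ⟩
  (1ℤ +ℤ + n) *ℤ e     ≡⟨ cong (_*ℤ e) (sym (pos-+ 1 n)) ⟩
  + suc n *ℤ e         ∎
  where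
  distrib : ∀ e m → e +ℤ m *ℤ e ≡ (1ℤ +ℤ m) *ℤ e
  distrib = solve-∀

∑-point : ∀ n (h : Fin n → ℤ) d → (∀ c → c ≢ d → h c ≡ 0ℤ) → ∑ n h ≡ h d
∑-point (suc n) h zero vanish = begin
  h zero +ℤ ∑ n (h ∘ suc)
    ≡⟨ cong (h zero +ℤ_) (trans (∑-cong n (λ c → vanish (suc c) λ ())) (∑-zero n)) ⟩
  h zero +ℤ 0ℤ             ≡⟨ +-identityʳ (h zero) ⟩
  h zero                   ∎
∑-point (suc n) h (suc d) vanish = begin
  h zero +ℤ ∑ n (h ∘ suc)
    ≡⟨ cong₂ _+ℤ_ (vanish zero λ ()) (∑-point n (h ∘ suc) d λ c c≢d → vanish (suc c) (c≢d ∘ suc-injective)) ⟩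
  0ℤ +ℤ h (suc d)          ≡⟨ +-identityˡ (h (suc d)) ⟩
  h (suc d)                ∎

I-refl : ∀ n (a : Fin n) → I n a a ≡ 1ℤ
I-refl n a with a ≟ a
... | yes _   = refl
... | no  a≢a = ⊥-elim (a≢a refl)

I-≢ : ∀ n (a b : Fin n) → a ≢ b → I n a b ≡ 0ℤ
I-≢ n a b a≢b with a ≟ b
... | yes a≡b = ⊥-elim (a≢b a≡b)
... | no  _   = refl

∑-indicator : ∀ n (d : Fin n) e → ∑ n (λ c → I n d c *ℤ e) ≡ e
∑-indicator n d e = begin
  ∑ n (λ c → I n d c *ℤ e)  ≡⟨ ∑-point n _ d (λ c c≢d → trans (cong (_*ℤ e) (I-≢ n d c (≢-sym c≢d))) (*-zeroˡ e)) ⟩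
  I n d d *ℤ e              ≡⟨ cong (_*ℤ e) (I-refl n d) ⟩
  1ℤ *ℤ e                   ≡⟨ *-identityˡ e ⟩
  e                         ∎

∑-split : ∀ m n (g : Fin (m ℕ.+ n) → ℤ) → ∑ (m ℕ.+ n) g ≡ ∑ m (λ i → g (i ↑ˡ n)) +ℤ ∑ n (λ i → g (m ↑ʳ i))
∑-split zero    n g = sym (+-identityˡ _)
∑-split (suc m) n g = trans (cong (g zero +ℤ_) (∑-split m n (g ∘ suc))) (sym (+-assoc (g zero) _ _))

∑-combine : ∀ m n (g : Fin (m * n) → ℤ) → ∑ (m * n) g ≡ ∑ m (λ c → ∑ n (λ z → g (combine c z)))
∑-combine zero    n g = refl
∑-combine (suc m) n g =
  trans (∑-split n (m * n) g) (cong (∑ n (λ z → g (z ↑ˡ m * n)) +ℤ_) (∑-combine m n (λ i → g (n ↑ʳ i))))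

tilde-block : ∀ {v r} (C : Fin r → Matrix v v) (L : Square (suc r)) a x b y →
  tilde C L (combine a x) (combine b y) ≡ Cext C (L a b) x y
tilde-block {v} {r} C L a x b y =
  cong₂ (λ P Q → Cext C (L (proj₁ P) (proj₁ Q)) (proj₂ P) (proj₂ Q))
        (remQuot-combine {suc r} {v} a x) (remQuot-combine {suc r} {v} b y)

K-block : ∀ m n (a : Fin m) x b y → K m n (combine a x) (combine b y) ≡ I m a b
K-block m n a x b y =
  cong₂ (λ P Q → I m (proj₁ P) (proj₁ Q)) (remQuot-combine {m} {n} a x) (remQuot-combine {m} {n} b y)

≐-from-blocks : ∀ {m n} (A B : Matrix (m * n) (m * n)) →
  (∀ (a : Fin m) (x : Fin n) (b : Fin m) (y : Fin n) → A (combine a x) (combine b y) ≡ B (combine a x) (combine b y)) →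
  A ≐ B
≐-from-blocks {m} {n} A B blocks p q =
  subst₂ (λ p′ q′ → A p′ q′ ≡ B p′ q′) (combine-remQuot {m} n p) (combine-remQuot {m} n q)
    (blocks (proj₁ (remQuot {m} n p)) (proj₂ (remQuot {m} n p)) (proj₁ (remQuot {m} n q)) (proj₂ (remQuot {m} n q)))

tilde-product-block : ∀ {v r} (C : Fin r → Matrix v v) (L L′ : Square (suc r)) a x b y →
  (tilde C L ⊗ tilde C L′) (combine a x) (combine b y) ≡ ∑ (suc r) (λ c → (Cext C (L a c) ⊗ Cext C (L′ c b)) x y)
tilde-product-block {v} {r} C L L′ a x b y =
  trans (∑-combine (suc r) v _) (∑-cong (suc r) λ c → ∑-cong v λ z →
    cong₂ _*ℤ_ (tilde-block C L a x c z) (tilde-block C L′ c z b y))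

TakesOnlyAt : ∀ {n} {A : Set} → (Fin n → A) → A → Fin n → Set
TakesOnlyAt x σ c = (x c ≡ σ) × (∀ c′ → x c′ ≡ σ → c′ ≡ c)

AgreeOnlyAt : ∀ {n} {A : Set} → (Fin n → A) → (Fin n → A) → Fin n → Set
AgreeOnlyAt x y m = (x m ≡ y m) × (∀ c → x c ≡ y c → c ≡ m)

module BlockProducts {v r} (k μ : ℕ) (k≥1 : k ≥ 1) (C : Fin r → Matrix v v)
  (C-square : ∀ i → C i ⊗ (C i ᵀ) ≐ (+ k) · C i)
  (C-cross : ∀ i j → i ≢ j → C i ⊗ (C j ᵀ) ≐ (+ μ) · J v) where

  -- k C_w = C_w C_wᵀ is symmetric and k ≠ 0, so C_w is symmetric.
  C-symmetric : ∀ w p q → C w p q ≡ C w q p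
  C-symmetric w p q = *-cancelˡ-≡ (+ k) _ _ {{ℕ.>-nonZero k≥1}} (begin
    + k *ℤ C w p q                   ≡⟨ sym (C-square w p q) ⟩
    ∑ v (λ t → C w p t *ℤ C w q t)  ≡⟨ ∑-cong v (λ t → *-comm (C w p t) (C w q t)) ⟩
    ∑ v (λ t → C w q t *ℤ C w p t)  ≡⟨ C-square w q p ⟩
    + k *ℤ C w q p                   ∎)

  P : Fin (suc r) → Fin (suc r) → Matrix v v
  P s t = Cext C s ⊗ Cext C t

  P-zeroˡ : ∀ t X Y → P zero t X Y ≡ 0ℤ
  P-zeroˡ t X Y = trans (∑-cong v (λ z → *-zeroˡ (Cext C t z Y))) (∑-zero v)

  P-zeroʳ : ∀ s X Y → P s zero X Y ≡ 0ℤ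
  P-zeroʳ s X Y = trans (∑-cong v (λ z → *-zeroʳ (Cext C s X z))) (∑-zero v)

  P-diag : ∀ s X Y → P s s X Y ≡ + k *ℤ Cext C s X Y
  P-diag zero    X Y = trans (P-zeroˡ zero X Y) (sym (*-zeroʳ (+ k)))
  P-diag (suc w) X Y = trans (∑-cong v (λ z → cong (C w X z *ℤ_) (C-symmetric w z Y))) (C-square w X Y)

  P-off : ∀ s t X Y → s ≢ zero → t ≢ zero → s ≢ t → P s t X Y ≡ + μ
  P-off zero    _       X Y s≢0 _   _   = ⊥-elim (s≢0 refl)
  P-off (suc _) zero    X Y _   t≢0 _   = ⊥-elim (t≢0 refl)
  P-off (suc u) (suc w) X Y _   _   s≢t = begin
    ∑ v (λ z → C u X z *ℤ C w z Y)  ≡⟨ ∑-cong v (λ z → cong (C u X z *ℤ_) (C-symmetric w z Y)) ⟩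
    (C u ⊗ (C w ᵀ)) X Y              ≡⟨ C-cross u w (s≢t ∘ cong suc) X Y ⟩
    + μ *ℤ 1ℤ                        ≡⟨ *-identityʳ (+ μ) ⟩
    + μ                              ∎

  -- Column count for two rows x, y that vanish only in the distinct columns a, b
  -- and agree only in column m: the columns a, b contribute 0, column m
  -- contributes k C_{x_m}, and the remaining r - 2 columns contribute μ each.
  module OffDiagonal (x y : Fin (suc r) → Fin (suc r)) (a b m : Fin (suc r)) (a≢b : a ≢ b)
    (x-only : TakesOnlyAt x zero a) (y-only : TakesOnlyAt y zero b) (agreement : AgreeOnlyAt x y m)
    (X Y : Fin v) where

    T : Fin (suc r) → ℤ
    T c = P (x c) (y c) X Y

    -- the correction of column m relative to a generic column
    D : ℤ
    D = + k *ℤ Cext C (x m) X Y +ℤ - + μ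

    -- every column contributes μ, corrected in the three special columns a, b, m
    S : Fin (suc r) → ℤ
    S c = I (suc r) a c *ℤ - + μ +ℤ (I (suc r) b c *ℤ - + μ +ℤ I (suc r) m c *ℤ D)

    m≢a : m ≢ a
    m≢a refl = a≢b (proj₂ y-only m (trans (sym (proj₁ agreement)) (proj₁ x-only)))

    m≢b : m ≢ b
    m≢b refl = a≢b (sym (proj₂ x-only m (trans (proj₁ agreement) (proj₁ y-only))))

    column : ∀ c → T c ≡ + μ +ℤ S c
    column c with c ≟ a
    ... | yes refl rewrite I-refl (suc r) a | I-≢ (suc r) b a (≢-sym a≢b) | I-≢ (suc r) m a m≢a
      = trans (cong (λ s → P s (y a) X Y) (proj₁ x-only)) (trans (P-zeroˡ (y a) X Y) (cancel-a (+ μ) D))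
      where
      cancel-a : ∀ M D → 0ℤ ≡ M +ℤ (1ℤ *ℤ - M +ℤ (0ℤ *ℤ - M +ℤ 0ℤ *ℤ D))
      cancel-a = solve-∀
    ... | no c≢a with c ≟ b
    ...   | yes refl rewrite I-≢ (suc r) a b a≢b | I-refl (suc r) b | I-≢ (suc r) m b m≢b
      = trans (cong (λ t → P (x b) t X Y) (proj₁ y-only)) (trans (P-zeroʳ (x b) X Y) (cancel-b (+ μ) D))
      where
      cancel-b : ∀ M D → 0ℤ ≡ M +ℤ (0ℤ *ℤ - M +ℤ (1ℤ *ℤ - M +ℤ 0ℤ *ℤ D))
      cancel-b = solve-∀
    ...   | no c≢b with c ≟ m
    ...     | yes refl rewrite I-≢ (suc r) a m (≢-sym c≢a) | I-≢ (suc r) b m (≢-sym c≢b) | I-refl (suc r) m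
      = trans (cong (λ t → P (x m) t X Y) (sym (proj₁ agreement))) (trans (P-diag (x m) X Y) (shift (+ μ) _))
      where
      shift : ∀ M E → E ≡ M +ℤ (0ℤ *ℤ - M +ℤ (0ℤ *ℤ - M +ℤ 1ℤ *ℤ (E +ℤ - M)))
      shift = solve-∀
    ...     | no c≢m rewrite I-≢ (suc r) a c (≢-sym c≢a) | I-≢ (suc r) b c (≢-sym c≢b) | I-≢ (suc r) m c (≢-sym c≢m)
      = trans (P-off (x c) (y c) X Y (c≢a ∘ proj₂ x-only c) (c≢b ∘ proj₂ y-only c) (c≢m ∘ proj₂ agreement c))
              (generic (+ μ) D)
      where
      generic : ∀ M D → M ≡ M +ℤ (0ℤ *ℤ - M +ℤ (0ℤ *ℤ - M +ℤ 0ℤ *ℤ D))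
      generic = solve-∀

    ∑S : ∑ (suc r) S ≡ - + μ +ℤ (- + μ +ℤ D)
    ∑S = begin
      ∑ (suc r) S
        ≡⟨ ∑-+ (suc r) (λ c → I (suc r) a c *ℤ - + μ) (λ c → I (suc r) b c *ℤ - + μ +ℤ I (suc r) m c *ℤ D) ⟩
      ∑ (suc r) (λ c → I (suc r) a c *ℤ - + μ) +ℤ ∑ (suc r) (λ c → I (suc r) b c *ℤ - + μ +ℤ I (suc r) m c *ℤ D)
        ≡⟨ cong₂ _+ℤ_ (∑-indicator (suc r) a _) (∑-+ (suc r) (λ c → I (suc r) b c *ℤ - + μ) (λ c → I (suc r) m c *ℤ D)) ⟩
      - + μ +ℤ (∑ (suc r) (λ c → I (suc r) b c *ℤ - + μ) +ℤ ∑ (suc r) (λ c → I (suc r) m c *ℤ D))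
        ≡⟨ cong (- + μ +ℤ_) (cong₂ _+ℤ_ (∑-indicator (suc r) b _) (∑-indicator (suc r) m D)) ⟩
      - + μ +ℤ (- + μ +ℤ D) ∎

    row-sum-off-diagonal :
      ∑ (suc r) T ≡ (+ k *ℤ Cext C (x m) X Y +ℤ + (2 * μ) *ℤ I (suc r) a b) +ℤ (+ r - + 2) *ℤ + μ
    row-sum-off-diagonal = begin
      ∑ (suc r) T                                   ≡⟨ ∑-cong (suc r) column ⟩
      ∑ (suc r) (λ c → + μ +ℤ S c)                  ≡⟨ ∑-+ (suc r) (λ _ → + μ) S ⟩
      ∑ (suc r) (λ _ → + μ) +ℤ ∑ (suc r) S          ≡⟨ cong₂ _+ℤ_ (∑-const (suc r) (+ μ)) ∑S ⟩
      + suc r *ℤ + μ +ℤ (- + μ +ℤ (- + μ +ℤ D))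
        ≡⟨ cong (λ t → t *ℤ + μ +ℤ (- + μ +ℤ (- + μ +ℤ D))) (pos-+ 1 r) ⟩
      (1ℤ +ℤ + r) *ℤ + μ +ℤ (- + μ +ℤ (- + μ +ℤ D)) ≡⟨ count (+ r) (+ μ) (+ k *ℤ Cext C (x m) X Y) (+ (2 * μ)) ⟩
      (+ k *ℤ Cext C (x m) X Y +ℤ + (2 * μ) *ℤ 0ℤ) +ℤ (+ r - + 2) *ℤ + μ
        ≡⟨ cong (λ t → (+ k *ℤ Cext C (x m) X Y +ℤ + (2 * μ) *ℤ t) +ℤ (+ r - + 2) *ℤ + μ) (sym (I-≢ (suc r) a b a≢b)) ⟩
      (+ k *ℤ Cext C (x m) X Y +ℤ + (2 * μ) *ℤ I (suc r) a b) +ℤ (+ r - + 2) *ℤ + μ ∎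
      where
      count : ∀ R M E N → (1ℤ +ℤ R) *ℤ M +ℤ (- M +ℤ (- M +ℤ (E +ℤ - M))) ≡ (E +ℤ N *ℤ 0ℤ) +ℤ (R - + 2) *ℤ M
      count = solve-∀

  -- Column count for two rows vanishing only in the same column a: then m = a,
  -- column a contributes 0 and the other r columns contribute μ each.
  module Diagonal (x y : Fin (suc r) → Fin (suc r)) (a m : Fin (suc r))
    (x-only : TakesOnlyAt x zero a) (y-only : TakesOnlyAt y zero a) (agreement : AgreeOnlyAt x y m)
    (X Y : Fin v) where

    T : Fin (suc r) → ℤ
    T c = P (x c) (y c) X Y

    -- the rows agree in column a, where both vanish, so m = a
    m≡a : m ≡ a
    m≡a = sym (proj₂ agreement a (trans (proj₁ x-only) (sym (proj₁ y-only))))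

    column : ∀ c → T c ≡ + μ +ℤ I (suc r) a c *ℤ - + μ
    column c with c ≟ a
    ... | yes refl rewrite I-refl (suc r) a
      = trans (cong (λ s → P s (y a) X Y) (proj₁ x-only)) (trans (P-zeroˡ (y a) X Y) (cancel (+ μ)))
      where
      cancel : ∀ M → 0ℤ ≡ M +ℤ 1ℤ *ℤ - M
      cancel = solve-∀
    ... | no c≢a rewrite I-≢ (suc r) a c (≢-sym c≢a)
      = trans (P-off (x c) (y c) X Y (c≢a ∘ proj₂ x-only c) (c≢a ∘ proj₂ y-only c)
                     (λ e → c≢a (trans (proj₂ agreement c e) m≡a)))
              (generic (+ μ))
      where
      generic : ∀ M → M ≡ M +ℤ 0ℤ *ℤ - M
      generic = solve-∀

    row-sum-diagonal :
      ∑ (suc r) T ≡ (+ k *ℤ Cext C (x m) X Y +ℤ + (2 * μ) *ℤ I (suc r) a a) +ℤ (+ r - + 2) *ℤ + μ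
    row-sum-diagonal = begin
      ∑ (suc r) T                                      ≡⟨ ∑-cong (suc r) column ⟩
      ∑ (suc r) (λ c → + μ +ℤ I (suc r) a c *ℤ - + μ)
        ≡⟨ ∑-+ (suc r) (λ _ → + μ) (λ c → I (suc r) a c *ℤ - + μ) ⟩
      ∑ (suc r) (λ _ → + μ) +ℤ ∑ (suc r) (λ c → I (suc r) a c *ℤ - + μ)
        ≡⟨ cong₂ _+ℤ_ (∑-const (suc r) (+ μ)) (∑-indicator (suc r) a _) ⟩
      + suc r *ℤ + μ +ℤ - + μ                          ≡⟨ cong (λ t → t *ℤ + μ +ℤ - + μ) (pos-+ 1 r) ⟩
      (1ℤ +ℤ + r) *ℤ + μ +ℤ - + μ                      ≡⟨ count (+ r) (+ μ) (+ k) ⟩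
      (+ k *ℤ 0ℤ +ℤ (+ 2 *ℤ + μ) *ℤ 1ℤ) +ℤ (+ r - + 2) *ℤ + μ
        ≡⟨ sym (cong₂ (λ s t → (+ k *ℤ s +ℤ t) +ℤ (+ r - + 2) *ℤ + μ) x-at-m diagonal) ⟩
      (+ k *ℤ Cext C (x m) X Y +ℤ + (2 * μ) *ℤ I (suc r) a a) +ℤ (+ r - + 2) *ℤ + μ ∎
      where
      x-at-m : Cext C (x m) X Y ≡ 0ℤ
      x-at-m = cong (λ s → Cext C s X Y) (trans (cong x m≡a) (proj₁ x-only))

      diagonal : + (2 * μ) *ℤ I (suc r) a a ≡ (+ 2 *ℤ + μ) *ℤ 1ℤ
      diagonal = cong₂ _*ℤ_ (pos-* 2 μ) (I-refl (suc r) a)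

      count : ∀ R M K → (1ℤ +ℤ R) *ℤ M +ℤ - M ≡ (K *ℤ 0ℤ +ℤ (+ 2 *ℤ M) *ℤ 1ℤ) +ℤ (R - + 2) *ℤ M
      count = solve-∀

  row-sum : (x y : Fin (suc r) → Fin (suc r)) (a b m : Fin (suc r)) →
    TakesOnlyAt x zero a → TakesOnlyAt y zero b → AgreeOnlyAt x y m → ∀ X Y →
    ∑ (suc r) (λ c → P (x c) (y c) X Y)
      ≡ (+ k *ℤ Cext C (x m) X Y +ℤ + (2 * μ) *ℤ I (suc r) a b) +ℤ (+ r - + 2) *ℤ + μ
  row-sum x y a b m x-only y-only agreement X Y = by-cases (a ≟ b)
    where
    by-cases : Dec (a ≡ b) → ∑ (suc r) (λ c → P (x c) (y c) X Y)
      ≡ (+ k *ℤ Cext C (x m) X Y +ℤ + (2 * μ) *ℤ I (suc r) a b) +ℤ (+ r - + 2) *ℤ + μ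
    by-cases (yes refl) = Diagonal.row-sum-diagonal x y a m x-only y-only agreement X Y
    by-cases (no a≢b)   = OffDiagonal.row-sum-off-diagonal x y a b m a≢b x-only y-only agreement X Y

latin-row-only : ∀ {s} {L : Square s} → IsLatin L → ∀ a c → TakesOnlyAt (L a) (L a c) c
latin-row-only {L = L} (rows , _) a c with rows a (L a c)
... | _ , _ , unique = refl , λ c′ e → trans (unique c′ e) (sym (unique c refl))

zero-diagonal-row : ∀ {s} {L : Square (suc s)} → IsLatin L → (∀ a → L a a ≡ zero) →
  ∀ a → TakesOnlyAt (L a) zero a
zero-diagonal-row latin diagonal a =
  diagonal a , λ c e → proj₂ (latin-row-only latin a a) c (trans e (sym (diagonal a)))

-- For linked MOLS, L_{j,l} is the transpose of L_{l,j}: both are obtained from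
-- L_{j,i} and L_{l,i} for any third index i.
linked-transpose : ∀ {s f} {L : Fin f → Fin f → Square s} → LinkedMOLS f L →
  ∀ {i j l} → i ≢ j → j ≢ l → i ≢ l → ∀ c b → L j l c b ≡ L l j b c
linked-transpose (_ , link) i≢j j≢l i≢l c b with link _ _ _ j≢l (≢-sym i≢l) (≢-sym i≢j)
... | orth , obtained-jl with orth c b
...   | d , agree , _ =
  trans (obtained-jl c b d agree)
        (trans agree (sym (proj₂ (link _ _ _ (≢-sym j≢l) (≢-sym i≢j) (≢-sym i≢l)) b c d (sym agree))))

proposition7p2 : (v k r λ' μ : ℕ) → v ≥ 1 → k ≥ 1 → r ≥ 1 → λ' ≥ 1 → μ ≥ 1 →
    (C : Fin r → Matrix v v) →
    (∀ i → Is01 (C i)) →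
    ∑M r C ≐ ((((+ r) - (+ λ')) · I v) ⊕ ((+ λ') · J v)) →
    (∀ i → C i ⊗ (C i ᵀ) ≐ (+ k) · C i) →
    (∀ i j → i ≢ j → C i ⊗ (C j ᵀ) ≐ (+ μ) · J v) →
    (f : ℕ) → f ≥ 3 →
    (L : Fin f → Fin f → Square (suc r)) →
    LinkedMOLS f L →
    (∀ i j → i ≢ j → ∀ a → L i j a a ≡ Fin.zero) →
    ∀ i j l → i ≢ j → j ≢ l → i ≢ l →
    tilde C (L i j) ⊗ tilde C (L j l) ≐
    (((+ k) · tilde C (L i l)) ⊕ ((+ (2 * μ)) · K (suc r) v))
    ⊕ ((((+ r) - (+ 2)) *ℤ (+ μ)) · J (suc r * v))
proposition7p2 v k r _ μ _ k≥1 _ _ _ C _ _ C-square C-cross _ _ L linked zero-diagonal i j l i≢j j≢l i≢l =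
  ≐-from-blocks _ _ block
  where
  open BlockProducts k μ k≥1 C C-square C-cross

  zero-row : ∀ {i′ j′} → i′ ≢ j′ → ∀ a → TakesOnlyAt (L i′ j′ a) zero a
  zero-row {i′} {j′} i′≢j′ = zero-diagonal-row (proj₁ linked i′ j′ i′≢j′) (zero-diagonal i′ j′ i′≢j′)

  block : ∀ (a : Fin (suc r)) (X : Fin v) (b : Fin (suc r)) (Y : Fin v) →
    (tilde C (L i j) ⊗ tilde C (L j l)) (combine a X) (combine b Y)
    ≡ (+ k *ℤ tilde C (L i l) (combine a X) (combine b Y) +ℤ + (2 * μ) *ℤ K (suc r) v (combine a X) (combine b Y))
      +ℤ ((+ r - + 2) *ℤ + μ) *ℤ 1ℤ
  block a X b Y with proj₂ linked i l j i≢l (≢-sym j≢l) i≢j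
  ... | orth , obtained-il with orth a b
  ...   | m , agreement = begin
    (tilde C (L i j) ⊗ tilde C (L j l)) (combine a X) (combine b Y)
      ≡⟨ tilde-product-block C (L i j) (L j l) a X b Y ⟩
    ∑ (suc r) (λ c → P (L i j a c) (L j l c b) X Y)
      ≡⟨ ∑-cong (suc r) (λ c → cong (λ t → P (L i j a c) t X Y) (linked-transpose linked i≢j j≢l i≢l c b)) ⟩
    ∑ (suc r) (λ c → P (L i j a c) (L l j b c) X Y)
      ≡⟨ row-sum (L i j a) (L l j b) a b m (zero-row i≢j a) (zero-row (≢-sym j≢l) b) agreement X Y ⟩
    (+ k *ℤ Cext C (L i j a m) X Y +ℤ + (2 * μ) *ℤ I (suc r) a b) +ℤ (+ r - + 2) *ℤ + μ
      ≡⟨ cong₂ _+ℤ_ (cong₂ (λ s t → + k *ℤ s +ℤ + (2 * μ) *ℤ t) tilde-il (sym (K-block (suc r) v a X b Y)))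
                    (sym (*-identityʳ _)) ⟩
    (+ k *ℤ tilde C (L i l) (combine a X) (combine b Y) +ℤ + (2 * μ) *ℤ K (suc r) v (combine a X) (combine b Y))
      +ℤ ((+ r - + 2) *ℤ + μ) *ℤ 1ℤ ∎
    where
    -- L_il(a,b) is the common value of the two rows in column m
    tilde-il : Cext C (L i j a m) X Y ≡ tilde C (L i l) (combine a X) (combine b Y)
    tilde-il = sym (trans (tilde-block C (L i l) a X b Y)
                          (cong (λ σ → Cext C σ X Y) (obtained-il a b m (proj₁ agreement))))
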